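{- Let $\mathcal{D}=(G,x,y)$ be a regular dessin with $G$ nilpotent, let $K=\langle x\rangle\cap\langle y\rangle$ and $\bar G=G/K$, so that $(\bar G,xK,yK)$ is the shadow dessin. If $G$ has nilpotency class $c\ge 2$, then $c-1\le c(\bar G)\le c$. Conversely, if $\bar G$ has nilpotency class $c$, then $c\le c(G)\le c+1$.
   Context: A regular dessin is a triple $(G,x,y)$ with $G$ a finite group generated by $x,y$. Its shadow dessin is $(G/K,xK,yK)$ with $K=\langle x\rangle\cap\langle y\rangle$ (a central, hence normal, subgroup). $c(H)$ denotes the nilpotency class of a nilpotent group $H$. -}

module Defs where

open import Level using (Level; _⊔_; Lift; lift)
open import Algebra.Bundles using (Group)
open import Algebra.Structures using (IsGroup; IsMonoid; IsSemigroup; IsMagma)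
open import Data.Nat using (ℕ; zero; suc; _≤_)
open import Data.Fin using (Fin)
open import Data.Product using (Σ; ∃; ∃₂; _×_; _,_; proj₁; proj₂)
open import Data.Sum using (_⊎_; inj₁; inj₂)
open import Data.Unit using (⊤)
open import Relation.Unary using (Pred)
import Algebra.Properties.Group as GP
import Relation.Binary.Reasoning.Setoid as SetoidReasoning

module _ {c ℓ : Level} (G : Group c ℓ) where
  open Group G

  data Gen {p : Level} (S : Pred Carrier p) : Carrier → Set (c ⊔ ℓ ⊔ p) where
    gen   : ∀ {g} → S g → Gen S g
    gen-ε : Gen S ε
    gen-⁻¹ : ∀ {g} → Gen S g → Gen S (g ⁻¹)
    gen-∙ : ∀ {g h} → Gen S g → Gen S h → Gen S (g ∙ h)
    gen-≈ : ∀ {g h} → g ≈ h → Gen S g → Gen S h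

  Cyclic : Carrier → Pred Carrier (c ⊔ ℓ)
  Cyclic x = Gen (λ g → g ≈ x)

  GeneratedBy : Carrier → Carrier → Set (c ⊔ ℓ)
  GeneratedBy x y = ∀ g → Gen (λ h → h ≈ x ⊎ h ≈ y) g

  IsFinite : Set (c ⊔ ℓ)
  IsFinite = Σ ℕ λ n → Σ (Fin n → Carrier) λ f → ∀ g → ∃ λ i → f i ≈ g

  comm : Carrier → Carrier → Carrier
  comm a b = a ⁻¹ ∙ b ⁻¹ ∙ a ∙ b

  -- lower central series: lcs i = γ_{i+1}(G), so lcs 0 = G and
  -- lcs (i+1) = [lcs i , G]
  lcs : ℕ → Pred Carrier (c ⊔ ℓ)
  lcs zero    = λ _ → Lift (c ⊔ ℓ) ⊤
  lcs (suc i) = Gen (λ g → ∃₂ λ a b → lcs i a × g ≈ comm a b)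

  ClassAtMost : ℕ → Set (c ⊔ ℓ)
  ClassAtMost n = ∀ g → lcs n g → g ≈ ε

  Nilpotent : Set (c ⊔ ℓ)
  Nilpotent = Σ ℕ ClassAtMost

  HasClass : ℕ → Set (c ⊔ ℓ)
  HasClass n = ClassAtMost n × (∀ m → ClassAtMost m → n ≤ m)

  Inter : Carrier → Carrier → Pred Carrier (c ⊔ ℓ)
  Inter x y g = Cyclic x g × Cyclic y g

-- Quotient of a group by a central subgroup (setoid quotient: same
-- carrier, a ~ b iff a b⁻¹ ∈ N).

module CentralQuotient {c ℓ p : Level} (G : Group c ℓ) (N : Pred (Group.Carrier G) p)
  (N-ε : N (Group.ε G))
  (N-⁻¹ : ∀ {a} → N a → N (Group._⁻¹ G a))
  (N-∙ : ∀ {a b} → N a → N b → N (Group._∙_ G a b))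
  (N-≈ : ∀ {a b} → Group._≈_ G a b → N a → N b)
  (central : ∀ k g → N k → Group._≈_ G (Group._∙_ G k g) (Group._∙_ G g k)) where

  open Group G
  open GP G
  open SetoidReasoning setoid

  _~_ : Carrier → Carrier → Set p
  a ~ b = N (a ∙ b ⁻¹)

  ≈⇒~ : ∀ {a b} → a ≈ b → a ~ b
  ≈⇒~ {a} {b} eq = N-≈ (sym (trans (∙-congʳ eq) (inverseʳ b))) N-ε

  ~-sym : ∀ {a b} → a ~ b → b ~ a
  ~-sym {a} {b} n = N-≈ (⁻¹-anti-homo-// a b) (N-⁻¹ n)

  cancel : ∀ a b c' → (a ∙ b ⁻¹) ∙ (b ∙ c' ⁻¹) ≈ a ∙ c' ⁻¹
  cancel a b c' = begin
    (a ∙ b ⁻¹) ∙ (b ∙ c' ⁻¹) ≈⟨ assoc a (b ⁻¹) (b ∙ c' ⁻¹) ⟩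
    a ∙ (b ⁻¹ ∙ (b ∙ c' ⁻¹)) ≈⟨ ∙-congˡ (assoc (b ⁻¹) b (c' ⁻¹)) ⟨
    a ∙ ((b ⁻¹ ∙ b) ∙ c' ⁻¹) ≈⟨ ∙-congˡ (∙-congʳ (inverseˡ b)) ⟩
    a ∙ (ε ∙ c' ⁻¹)          ≈⟨ ∙-congˡ (identityˡ (c' ⁻¹)) ⟩
    a ∙ c' ⁻¹                ∎

  ~-trans : ∀ {a b d} → a ~ b → b ~ d → a ~ d
  ~-trans {a} {b} {d} n m = N-≈ (cancel a b d) (N-∙ n m)

  ~-∙-cong : ∀ {a a' b b'} → a ~ a' → b ~ b' → (a ∙ b) ~ (a' ∙ b')
  ~-∙-cong {a} {a'} {b} {b'} n m = N-≈ eq (N-∙ n m)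
    where
    eq : (a ∙ a' ⁻¹) ∙ (b ∙ b' ⁻¹) ≈ (a ∙ b) ∙ (a' ∙ b') ⁻¹
    eq = begin
      (a ∙ a' ⁻¹) ∙ (b ∙ b' ⁻¹)  ≈⟨ assoc a (a' ⁻¹) (b ∙ b' ⁻¹) ⟩
      a ∙ (a' ⁻¹ ∙ (b ∙ b' ⁻¹))  ≈⟨ ∙-congˡ (central (b ∙ b' ⁻¹) (a' ⁻¹) m) ⟨
      a ∙ ((b ∙ b' ⁻¹) ∙ a' ⁻¹)  ≈⟨ ∙-congˡ (assoc b (b' ⁻¹) (a' ⁻¹)) ⟩
      a ∙ (b ∙ (b' ⁻¹ ∙ a' ⁻¹))  ≈⟨ assoc a b (b' ⁻¹ ∙ a' ⁻¹) ⟨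
      (a ∙ b) ∙ (b' ⁻¹ ∙ a' ⁻¹)  ≈⟨ ∙-congˡ (⁻¹-anti-homo-∙ a' b') ⟨
      (a ∙ b) ∙ (a' ∙ b') ⁻¹     ∎

  ~-⁻¹-cong : ∀ {a a'} → a ~ a' → (a ⁻¹) ~ (a' ⁻¹)
  ~-⁻¹-cong {a} {a'} n = N-≈ eq (~-sym n)
    where
    eq : a' ∙ a ⁻¹ ≈ a ⁻¹ ∙ a' ⁻¹ ⁻¹
    eq = begin
      a' ∙ a ⁻¹                ≈⟨ identityˡ (a' ∙ a ⁻¹) ⟨
      ε ∙ (a' ∙ a ⁻¹)          ≈⟨ ∙-congʳ (inverseˡ a) ⟨
      (a ⁻¹ ∙ a) ∙ (a' ∙ a ⁻¹) ≈⟨ assoc (a ⁻¹) a (a' ∙ a ⁻¹) ⟩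
      a ⁻¹ ∙ (a ∙ (a' ∙ a ⁻¹)) ≈⟨ ∙-congˡ (central (a' ∙ a ⁻¹) a (~-sym n)) ⟨
      a ⁻¹ ∙ ((a' ∙ a ⁻¹) ∙ a) ≈⟨ ∙-congˡ (assoc a' (a ⁻¹) a) ⟩
      a ⁻¹ ∙ (a' ∙ (a ⁻¹ ∙ a)) ≈⟨ ∙-congˡ (∙-congˡ (inverseˡ a)) ⟩
      a ⁻¹ ∙ (a' ∙ ε)          ≈⟨ ∙-congˡ (identityʳ a') ⟩
      a ⁻¹ ∙ a'                ≈⟨ ∙-congˡ (⁻¹-involutive a') ⟨
      a ⁻¹ ∙ a' ⁻¹ ⁻¹          ∎

  quotient : Group c p
  quotient = record
    { Carrier = Carrier
    ; _≈_ = _~_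
    ; _∙_ = _∙_
    ; ε = ε
    ; _⁻¹ = _⁻¹
    ; isGroup = record
      { isMonoid = record
        { isSemigroup = record
          { isMagma = record
            { isEquivalence = record
              { refl = ≈⇒~ refl ; sym = ~-sym ; trans = ~-trans }
            ; ∙-cong = ~-∙-cong }
          ; assoc = λ a b d → ≈⇒~ (assoc a b d) }
        ; identity = (λ a → ≈⇒~ (identityˡ a)) , (λ a → ≈⇒~ (identityʳ a)) }
      ; inverse = (λ a → ≈⇒~ (inverseˡ a)) , (λ a → ≈⇒~ (inverseʳ a))
      ; ⁻¹-cong = ~-⁻¹-cong }
    }

-- The shadow dessin group Ḡ = G / K with K = ⟨ x ⟩ ∩ ⟨ y ⟩, which is
-- central (hence normal) because G = ⟨ x , y ⟩.

module _ {c ℓ : Level} (G : Group c ℓ) where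
  open Group G
  open GP G
  open SetoidReasoning setoid

  Gen-commutes : ∀ {p} {S : Pred Carrier p} (k : Carrier) →
    (∀ {s} → S s → k ∙ s ≈ s ∙ k) → ∀ {g} → Gen G S g → k ∙ g ≈ g ∙ k
  Gen-commutes k h (gen s) = h s
  Gen-commutes k h gen-ε = trans (identityʳ k) (sym (identityˡ k))
  Gen-commutes k h (gen-⁻¹ {g} q) = begin
    k ∙ g ⁻¹                  ≈⟨ identityˡ (k ∙ g ⁻¹) ⟨
    ε ∙ (k ∙ g ⁻¹)            ≈⟨ ∙-congʳ (inverseˡ g) ⟨
    (g ⁻¹ ∙ g) ∙ (k ∙ g ⁻¹)   ≈⟨ assoc (g ⁻¹) g (k ∙ g ⁻¹) ⟩
    g ⁻¹ ∙ (g ∙ (k ∙ g ⁻¹))   ≈⟨ ∙-congˡ (assoc g k (g ⁻¹)) ⟨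
    g ⁻¹ ∙ ((g ∙ k) ∙ g ⁻¹)   ≈⟨ ∙-congˡ (∙-congʳ (Gen-commutes k h q)) ⟨
    g ⁻¹ ∙ ((k ∙ g) ∙ g ⁻¹)   ≈⟨ ∙-congˡ (assoc k g (g ⁻¹)) ⟩
    g ⁻¹ ∙ (k ∙ (g ∙ g ⁻¹))   ≈⟨ ∙-congˡ (∙-congˡ (inverseʳ g)) ⟩
    g ⁻¹ ∙ (k ∙ ε)            ≈⟨ ∙-congˡ (identityʳ k) ⟩
    g ⁻¹ ∙ k                  ∎
  Gen-commutes k h (gen-∙ {g} {g'} q q') = begin
    k ∙ (g ∙ g')   ≈⟨ assoc k g g' ⟨
    (k ∙ g) ∙ g'   ≈⟨ ∙-congʳ (Gen-commutes k h q) ⟩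
    (g ∙ k) ∙ g'   ≈⟨ assoc g k g' ⟩
    g ∙ (k ∙ g')   ≈⟨ ∙-congˡ (Gen-commutes k h q') ⟩
    g ∙ (g' ∙ k)   ≈⟨ assoc g g' k ⟨
    (g ∙ g') ∙ k   ∎
  Gen-commutes k h (gen-≈ eq q) =
    trans (∙-congˡ (sym eq)) (trans (Gen-commutes k h q) (∙-congʳ eq))

  Inter-central : ∀ x y → GeneratedBy G x y →
    ∀ k g → Inter G x y k → k ∙ g ≈ g ∙ k
  Inter-central x y genG k g (kx , ky) = Gen-commutes k step (genG g)
    where
    kx-comm : x ∙ k ≈ k ∙ x
    kx-comm = Gen-commutes x (λ {s} e → trans (∙-congˡ e) (∙-congʳ (sym e))) kx
    ky-comm : y ∙ k ≈ k ∙ y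
    ky-comm = Gen-commutes y (λ {s} e → trans (∙-congˡ e) (∙-congʳ (sym e))) ky
    step : ∀ {s} → (s ≈ x ⊎ s ≈ y) → k ∙ s ≈ s ∙ k
    step (inj₁ e) = trans (∙-congˡ e) (trans (sym kx-comm) (∙-congʳ (sym e)))
    step (inj₂ e) = trans (∙-congˡ e) (trans (sym ky-comm) (∙-congʳ (sym e)))

  ShadowGroup : (x y : Carrier) → GeneratedBy G x y → Group c (c ⊔ ℓ)
  ShadowGroup x y genG = CentralQuotient.quotient G (Inter G x y)
    (gen-ε , gen-ε)
    (λ (a , b) → gen-⁻¹ a , gen-⁻¹ b)
    (λ (a , b) (a' , b') → gen-∙ a a' , gen-∙ b b')
    (λ eq (a , b) → gen-≈ eq a , gen-≈ eq b)
    (Inter-central x y genG)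

module Submission where

-- The shadow group Ḡ = G/K is a quotient of G by the central subgroup
-- K = ⟨x⟩ ∩ ⟨y⟩.  Everything is proved for an arbitrary central quotient
-- G/N, which is the natural setting:
--   * the lower central series of G/N is the image of that of G
--     (γᵢ(G) maps into γᵢ(G/N), and every element of γᵢ(G/N) is the class
--     of an element of γᵢ(G)); hence  class(G) ≤ n  ⇒  class(G/N) ≤ n;
--   * if class(G/N) ≤ n then γₙ₊₁(G) ⊆ N ⊆ Z(G), so every commutator
--     generating γₙ₊₂(G) is trivial; hence  class(G/N) ≤ n ⇒ class(G) ≤ n+1.
-- A purely numeric "sandwich" lemma turns these two implications into
-- class(G/N) ≤ class(G) ≤ class(G/N) + 1, and both halves of the
-- proposition are rearrangements of this inequality.

open import Defs
open import Algebra.Bundles using (Group)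
open import Data.Nat using (ℕ; zero; suc; _≤_; _∸_)
open import Data.Nat.Properties using (∸-monoˡ-≤)
open import Data.Product using (_×_; _,_; ∃; ∃₂)
open import Level using (Level; _⊔_; lift)
open import Relation.Unary using (Pred; _⊆_)
import Algebra.Properties.Group as GroupProperties
import Relation.Binary.Reasoning.Setoid as SetoidReasoning

Commutators : {a ℓ : Level} (H : Group a ℓ) → ℕ → Pred (Group.Carrier H) (a ⊔ ℓ)
Commutators H i g = ∃₂ λ a b → lcs H i a × Group._≈_ H g (comm H a b)

module GroupFacts {a ℓ : Level} (G : Group a ℓ) where
  open Group G
  open GroupProperties G
  open SetoidReasoning setoid

  comm-trivial : ∀ g h → g ∙ h ≈ h ∙ g → comm G g h ≈ ε
  comm-trivial g h gh≈hg = begin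
    ((g ⁻¹ ∙ h ⁻¹) ∙ g) ∙ h ≈⟨ assoc (g ⁻¹ ∙ h ⁻¹) g h ⟩
    (g ⁻¹ ∙ h ⁻¹) ∙ (g ∙ h) ≈⟨ ∙-congˡ gh≈hg ⟩
    (g ⁻¹ ∙ h ⁻¹) ∙ (h ∙ g) ≈⟨ assoc (g ⁻¹) (h ⁻¹) (h ∙ g) ⟩
    g ⁻¹ ∙ (h ⁻¹ ∙ (h ∙ g)) ≈⟨ ∙-congˡ (\\-leftDividesʳ h g) ⟩
    g ⁻¹ ∙ g                ≈⟨ inverseˡ g ⟩
    ε                       ∎

  Gen-trivial : ∀ {p} {S : Pred Carrier p} → (∀ {g} → S g → g ≈ ε) →
    ∀ {g} → Gen G S g → g ≈ ε
  Gen-trivial triv (gen s)       = triv s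
  Gen-trivial triv gen-ε         = refl
  Gen-trivial triv (gen-⁻¹ q)    = trans (⁻¹-cong (Gen-trivial triv q)) ε⁻¹≈ε
  Gen-trivial triv (gen-∙ q r)   =
    trans (∙-cong (Gen-trivial triv q) (Gen-trivial triv r)) (identityˡ ε)
  Gen-trivial triv (gen-≈ eq q)  = trans (sym eq) (Gen-trivial triv q)

module CentralQuotientClass {a ℓ p : Level} (G : Group a ℓ)
  (N : Pred (Group.Carrier G) p)
  (N-ε : N (Group.ε G))
  (N-⁻¹ : ∀ {g} → N g → N (Group._⁻¹ G g))
  (N-∙ : ∀ {g h} → N g → N h → N (Group._∙_ G g h))
  (N-≈ : ∀ {g h} → Group._≈_ G g h → N g → N h)
  (central : ∀ k g → N k → Group._≈_ G (Group._∙_ G k g) (Group._∙_ G g k)) where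

  open Group G
  open GroupProperties G using (ε⁻¹≈ε)
  open GroupFacts G
  open CentralQuotient G N N-ε N-⁻¹ N-∙ N-≈ central using (quotient; ≈⇒~)
  private module Q = Group quotient

  -- G and G/N share carrier and operations, so a subgroup generated in G
  -- maps into the subgroup of G/N generated by any larger set.
  Gen-image : ∀ {s t} {S : Pred Carrier s} {T : Pred Carrier t} → S ⊆ T →
    Gen G S ⊆ Gen quotient T
  Gen-image S⊆T (gen s)      = gen (S⊆T s)
  Gen-image S⊆T gen-ε        = gen-ε
  Gen-image S⊆T (gen-⁻¹ q)   = gen-⁻¹ (Gen-image S⊆T q)
  Gen-image S⊆T (gen-∙ q r)  = gen-∙ (Gen-image S⊆T q) (Gen-image S⊆T r)
  Gen-image S⊆T (gen-≈ eq q) = gen-≈ (≈⇒~ eq) (Gen-image S⊆T q)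

  Gen-lift : ∀ {s t} {S : Pred Carrier s} {T : Pred Carrier t} →
    (∀ {g} → T g → ∃ λ h → Gen G S h × g Q.≈ h) →
    ∀ {g} → Gen quotient T g → ∃ λ h → Gen G S h × g Q.≈ h
  Gen-lift lift-T (gen t) = lift-T t
  Gen-lift lift-T gen-ε   = ε , gen-ε , Q.refl
  Gen-lift lift-T (gen-⁻¹ q) with Gen-lift lift-T q
  ... | h , h∈ , g~h = h ⁻¹ , gen-⁻¹ h∈ , Q.⁻¹-cong g~h
  Gen-lift lift-T (gen-∙ q r) with Gen-lift lift-T q | Gen-lift lift-T r
  ... | h , h∈ , g~h | h' , h'∈ , g'~h' = h ∙ h' , gen-∙ h∈ h'∈ , Q.∙-cong g~h g'~h'
  Gen-lift lift-T (gen-≈ eq q) with Gen-lift lift-T q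
  ... | h , h∈ , g~h = h , h∈ , Q.trans (Q.sym eq) g~h

  comm-congˡ : ∀ {g g'} h → g Q.≈ g' → comm quotient g h Q.≈ comm quotient g' h
  comm-congˡ h g~g' =
    Q.∙-cong (Q.∙-cong (Q.∙-cong (Q.⁻¹-cong g~g') Q.refl) g~g') Q.refl

  lcs-image : ∀ i → lcs G i ⊆ lcs quotient i
  lcs-image zero    _ = lift _
  lcs-image (suc i)   = Gen-image λ (g , h , g∈ , eq) → g , h , lcs-image i g∈ , ≈⇒~ eq

  lcs-lift : ∀ i {g} → lcs quotient i g → ∃ λ h → lcs G i h × g Q.≈ h
  lcs-lift zero    {g} _ = g , lift _ , Q.refl
  lcs-lift (suc i)       = Gen-lift lift-commutator
    where
    lift-commutator : ∀ {g} → Commutators quotient i g →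
      ∃ λ h → Gen G (Commutators G i) h × g Q.≈ h
    lift-commutator (g , h , g∈ , eq) with lcs-lift i g∈
    ... | g' , g'∈ , g~g' =
      comm G g' h , gen (g' , h , g'∈ , refl) , Q.trans eq (comm-congˡ h g~g')

  quotient-class : ∀ n → ClassAtMost G n → ClassAtMost quotient n
  quotient-class n classG g g∈ with lcs-lift n g∈
  ... | h , h∈ , g~h = Q.trans g~h (≈⇒~ (classG h h∈))

  trivial-in-quotient : ∀ {g} → g Q.≈ ε → N g
  trivial-in-quotient {g} g~ε = N-≈ (trans (∙-congˡ ε⁻¹≈ε) (identityʳ g)) g~ε

  -- class(G/N) ≤ n  ⇒  class(G) ≤ n + 1, since γₙ₊₁(G) ⊆ N is central.
  class-from-quotient : ∀ n → ClassAtMost quotient n → ClassAtMost G (suc n)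
  class-from-quotient n classQ _ = Gen-trivial commutator-trivial
    where
    commutator-trivial : ∀ {g} → Commutators G n g → g ≈ ε
    commutator-trivial (g , h , g∈ , eq) = trans eq (comm-trivial g h
      (central g h (trivial-in-quotient (classQ g (lcs-image n g∈)))))

class-sandwich : {a ℓ b m : Level} (G : Group a ℓ) (H : Group b m) →
  (∀ n → ClassAtMost G n → ClassAtMost H n) →
  (∀ n → ClassAtMost H n → ClassAtMost G (suc n)) →
  ∀ {c c'} → HasClass G c → HasClass H c' → c' ≤ c × c ≤ suc c'
class-sandwich G H down up {c} {c'} (classG , minG) (classH , minH) =
  minH c (down c classG) , minG (suc c') (up c' classH)

proposition3p8 : {a ℓ : Level} (G : Group a ℓ) (x y : Group.Carrier G) →
    IsFinite G → (genG : GeneratedBy G x y) → Nilpotent G →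
      ((c : ℕ) → 2 ≤ c → HasClass G c →
        (c' : ℕ) → HasClass (ShadowGroup G x y genG) c' → c ∸ 1 ≤ c' × c' ≤ c)
      × ((c : ℕ) → HasClass (ShadowGroup G x y genG) c →
        (c' : ℕ) → HasClass G c' → c ≤ c' × c' ≤ suc c)
proposition3p8 G x y _ genG _ =
  (λ _ _ hasClassG _ hasClassḠ →
     let c'≤c , c≤1+c' = sandwich hasClassG hasClassḠ in ∸-monoˡ-≤ 1 c≤1+c' , c'≤c)
  , (λ _ hasClassḠ _ hasClassG → sandwich hasClassG hasClassḠ)
  where
  -- Ḡ is (definitionally) the central quotient of G by K = ⟨x⟩ ∩ ⟨y⟩.
  open CentralQuotientClass G (Inter G x y)
    (gen-ε , gen-ε)
    (λ (p , q) → gen-⁻¹ p , gen-⁻¹ q)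
    (λ (p , q) (p' , q') → gen-∙ p p' , gen-∙ q q')
    (λ eq (p , q) → gen-≈ eq p , gen-≈ eq q)
    (Inter-central G x y genG)

  sandwich : ∀ {c c'} → HasClass G c → HasClass (ShadowGroup G x y genG) c' →
    c' ≤ c × c ≤ suc c'
  sandwich = class-sandwich G (ShadowGroup G x y genG) quotient-class class-from-quotient
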